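{- Let $g(q)=b_0+b_1q+\cdots+b_rq^r$ be a polynomial with real coefficients, let $s\ge0$, $d=r+s$, and suppose that $$f(q)=(1+q+\cdots+q^s)\,g(q)=\sum_{\ell=0}^dc_\ell q^\ell$$ has non-negative coefficients and is unimodal, i.e. there is $p$ with $c_0\le c_1\le\cdots\le c_p\ge c_{p+1}\ge\cdots\ge c_d$. Then all coefficients $b_0,\dots,b_r$ of $g$ are non-negative. -}

module Defs where

open import Level using (Level; suc; _⊔_)
open import Data.Nat as ℕ using (ℕ; zero) renaming (suc to sucℕ)
open import Data.List using (List; []; _∷_; map; replicate)
open import Data.Vec using (Vec; toList)
open import Relation.Binary.PropositionalEquality using (_≡_)
open import Data.Product using (∃; _×_)
open import Relation.Binary.Structures using (IsTotalOrder)
open import Algebra.Structures using (IsCommutativeRing)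

-- The coefficient ring of the paper is ℝ; since the standard library has no
-- reals, we state the result for every ordered commutative ring, ℝ included.
record OrderedCommRing (c ℓ : Level) : Set (suc (c ⊔ ℓ)) where
  infixl 7 _*_
  infixl 6 _+_
  infix 4 _≤_
  field
    Carrier : Set c
    _+_ _*_ : Carrier → Carrier → Carrier
    -_      : Carrier → Carrier
    0# 1#   : Carrier
    _≤_     : Carrier → Carrier → Set ℓ
    isCommutativeRing : IsCommutativeRing _≡_ _+_ _*_ -_ 0# 1#
    isTotalOrder      : IsTotalOrder _≡_ _≤_
    +-mono-≤ : ∀ {x y} z → x ≤ y → x + z ≤ y + z
    *-nonneg : ∀ {x y} → 0# ≤ x → 0# ≤ y → 0# ≤ x * y

module Poly {c ℓ} (R : OrderedCommRing c ℓ) where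
  open OrderedCommRing R

  -- polynomials as coefficient lists, constant term first
  _+ₚ_ : List Carrier → List Carrier → List Carrier
  [] +ₚ q = q
  (a ∷ p) +ₚ [] = a ∷ p
  (a ∷ p) +ₚ (b ∷ q) = (a + b) ∷ (p +ₚ q)

  _*ₚ_ : List Carrier → List Carrier → List Carrier
  [] *ₚ q = []
  (a ∷ p) *ₚ q = map (a *_) q +ₚ (0# ∷ (p *ₚ q))

  coeff : List Carrier → ℕ → Carrier
  coeff [] _ = 0#
  coeff (a ∷ p) zero = a
  coeff (a ∷ p) (sucℕ n) = coeff p n

  geom : ℕ → List Carrier
  geom s = replicate (sucℕ s) 1#

  fCoeff : ∀ {r} (s : ℕ) → Vec Carrier (sucℕ r) → ℕ → Carrier
  fCoeff s b = coeff (geom s *ₚ toList b)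

  NonnegCoeffs : (d : ℕ) → (ℕ → Carrier) → Set ℓ
  NonnegCoeffs d c = ∀ l → l ℕ.≤ d → 0# ≤ c l

  Unimodal : (d : ℕ) → (ℕ → Carrier) → Set ℓ
  Unimodal d c = ∃ λ p → p ℕ.≤ d
    × (∀ l → l ℕ.< p → c l ≤ c (sucℕ l))
    × (∀ l → p ℕ.≤ l → l ℕ.< d → c (sucℕ l) ≤ c l)

-- With c_l the coefficients of f and b_l those of g (zero outside 0 … r), comparing
-- consecutive coefficients of f = (1 + q + ⋯ + q^s) g gives
--   c_{l+1} - c_l = b_{l+1} - b_{l-s}.
-- On the increasing side (l < p) this reads b_{l+1} ≥ b_{l-s}, so b is non-negative up to
-- the peak by induction upwards from b_0 = c_0 ≥ 0.  On the decreasing side it reads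
-- b_l ≥ b_{l+s+1}, so b is non-negative from the peak on by induction downwards from the
-- vanishing coefficients beyond r.
module Submission where

open import Defs
open import Data.Nat as ℕ using (ℕ; zero; suc; z≤n; s≤s)
import Data.Nat.Properties as ℕ
open import Data.Nat.Induction using (<-rec)
open import Data.Fin using (Fin; toℕ)
import Data.Fin as Fin
open import Data.List using ([]; _∷_; map; replicate)
open import Data.Vec using (Vec; lookup; toList)
import Data.Vec as Vec
open import Data.Product using (_,_)
open import Data.Sum using (inj₁; inj₂)
open import Relation.Nullary using (yes; no)
open import Relation.Binary.PropositionalEquality
open import Algebra.Structures using (IsCommutativeRing)
open import Relation.Binary.Structures using (IsTotalOrder)

<-rec-downward : ∀ {p} (P : ℕ → Set p) (r : ℕ) →
  (∀ {m} → r ℕ.< m → P m) →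
  (∀ {m} → m ℕ.≤ r → (∀ {n} → m ℕ.< n → P n) → P m) →
  ∀ m → P m
<-rec-downward P r above step m = go (suc r) m (s≤s (ℕ.m≤m+n r m))
  where
  go : ∀ k m → r ℕ.< k ℕ.+ m → P m
  go zero    m r<m   = above r<m
  go (suc k) m r<1+k+m with m ℕ.≤? r
  ... | no m≰r  = above (ℕ.≰⇒> m≰r)
  ... | yes m≤r = step m≤r λ {n} m<n →
    go k n (ℕ.≤-<-trans (ℕ.≤-pred r<1+k+m) (ℕ.+-monoʳ-< k m<n))

module _ {c ℓ} (R : OrderedCommRing c ℓ) where
  open OrderedCommRing R
  open Poly R
  open IsCommutativeRing isCommutativeRing
    using (+-comm; +-assoc; +-identityˡ; +-identityʳ; -‿inverseʳ; *-identityˡ; zeroʳ)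
  open IsTotalOrder isTotalOrder using ()
    renaming (refl to ≤-refl; reflexive to ≤-reflexive; trans to ≤-trans)
  open ≡-Reasoning

  +-cancelʳ-≤ : ∀ {x y} z → x + z ≤ y + z → x ≤ y
  +-cancelʳ-≤ {x} {y} z x+z≤y+z =
    subst₂ _≤_ (+-inverse-cancel x) (+-inverse-cancel y) (+-mono-≤ (- z) x+z≤y+z)
    where
    +-inverse-cancel : ∀ u → u + z + - z ≡ u
    +-inverse-cancel u = begin
      u + z + - z    ≡⟨ +-assoc u z (- z) ⟩
      u + (z + - z)  ≡⟨ cong (u +_) (-‿inverseʳ z) ⟩
      u + 0#         ≡⟨ +-identityʳ u ⟩
      u              ∎

  ≤-balance : ∀ {a x y z} → z + y ≡ a + x → x ≤ z → y ≤ a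
  ≤-balance {a} {x} {y} {z} z+y≡a+x x≤z = +-cancelʳ-≤ x
    (subst₂ _≤_ (+-comm x y) (trans (+-comm z y) (trans (+-comm y z) z+y≡a+x))
      (+-mono-≤ y x≤z))

  coeff-+ₚ : ∀ p q n → coeff (p +ₚ q) n ≡ coeff p n + coeff q n
  coeff-+ₚ []      q       n       = sym (+-identityˡ _)
  coeff-+ₚ (a ∷ p) []      zero    = sym (+-identityʳ a)
  coeff-+ₚ (a ∷ p) []      (suc n) = sym (+-identityʳ _)
  coeff-+ₚ (a ∷ p) (b ∷ q) zero    = refl
  coeff-+ₚ (a ∷ p) (b ∷ q) (suc n) = coeff-+ₚ p q n

  coeff-map-* : ∀ a p n → coeff (map (a *_) p) n ≡ a * coeff p n
  coeff-map-* a []      n       = sym (zeroʳ a)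
  coeff-map-* a (b ∷ p) zero    = refl
  coeff-map-* a (b ∷ p) (suc n) = coeff-map-* a p n

  coeff-toList-≥ : ∀ {m} (b : Vec Carrier m) {n} → m ℕ.≤ n → coeff (toList b) n ≡ 0#
  coeff-toList-≥ Vec.[]      _         = refl
  coeff-toList-≥ (x Vec.∷ b) (s≤s m≤n) = coeff-toList-≥ b m≤n

  lookup≡coeff-toList : ∀ {m} (b : Vec Carrier m) i → lookup b i ≡ coeff (toList b) (toℕ i)
  lookup≡coeff-toList (x Vec.∷ b) Fin.zero    = refl
  lookup≡coeff-toList (x Vec.∷ b) (Fin.suc i) = lookup≡coeff-toList b i

  -- delay k B n = B (n - k), read as 0# when n < k.
  delay : ℕ → (ℕ → Carrier) → ℕ → Carrier
  delay zero    B n       = B n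
  delay (suc k) B zero    = 0#
  delay (suc k) B (suc n) = delay k B n

  delay-+ : ∀ k B n → delay k B (k ℕ.+ n) ≡ B n
  delay-+ zero    B n = refl
  delay-+ (suc k) B n = delay-+ k B n

  delay-nonneg : ∀ k B n → (∀ m → m ℕ.≤ n → 0# ≤ B m) → 0# ≤ delay k B n
  delay-nonneg zero    B n       B≥0 = B≥0 n ℕ.≤-refl
  delay-nonneg (suc k) B zero    B≥0 = ≤-refl
  delay-nonneg (suc k) B (suc n) B≥0 =
    delay-nonneg k B n λ m m≤n → B≥0 m (ℕ.m≤n⇒m≤1+n m≤n)

  -- windowSum k B n = B n + B (n - 1) + ⋯ + B (n - k + 1), the coefficients of
  -- (1 + q + ⋯ + q^(k-1)) · Σ B n qⁿ.
  windowSum : ℕ → (ℕ → Carrier) → ℕ → Carrier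
  windowSum zero    B n = 0#
  windowSum (suc k) B n = B n + delay 1 (windowSum k B) n

  coeff-replicate-1#-*ₚ : ∀ k p n → coeff (replicate k 1# *ₚ p) n ≡ windowSum k (coeff p) n
  coeff-replicate-1#-*ₚ zero    p n = refl
  coeff-replicate-1#-*ₚ (suc k) p n = begin
    coeff (map (1# *_) p +ₚ (0# ∷ (replicate k 1# *ₚ p))) n
      ≡⟨ coeff-+ₚ (map (1# *_) p) _ n ⟩
    coeff (map (1# *_) p) n + coeff (0# ∷ (replicate k 1# *ₚ p)) n
      ≡⟨ cong₂ _+_ (coeff-map-* 1# p n) (shifted n) ⟩
    1# * coeff p n + delay 1 (windowSum k (coeff p)) n
      ≡⟨ cong (_+ delay 1 (windowSum k (coeff p)) n) (*-identityˡ (coeff p n)) ⟩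
    windowSum (suc k) (coeff p) n
      ∎
    where
    shifted : ∀ n → coeff (0# ∷ (replicate k 1# *ₚ p)) n ≡ delay 1 (windowSum k (coeff p)) n
    shifted zero    = refl
    shifted (suc n) = coeff-replicate-1#-*ₚ k p n

  windowSum-suc : ∀ k B n → windowSum (suc k) B n ≡ windowSum k B n + delay k B n
  windowSum-suc zero    B zero    = trans (+-identityʳ (B 0)) (sym (+-identityˡ (B 0)))
  windowSum-suc zero    B (suc n) = trans (+-identityʳ (B (suc n))) (sym (+-identityˡ (B (suc n))))
  windowSum-suc (suc k) B zero    = sym (+-identityʳ _)
  windowSum-suc (suc k) B (suc n) = begin
    B (suc n) + windowSum (suc k) B n               ≡⟨ cong (B (suc n) +_) (windowSum-suc k B n) ⟩
    B (suc n) + (windowSum k B n + delay k B n)     ≡⟨ sym (+-assoc (B (suc n)) _ _) ⟩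
    B (suc n) + windowSum k B n + delay k B n       ∎

  windowSum-vanishes : ∀ {r} B → (∀ {n} → r ℕ.< n → B n ≡ 0#) →
    ∀ k {n} → k ℕ.+ r ℕ.≤ n → windowSum k B n ≡ 0#
  windowSum-vanishes B B-vanishes zero    _ = refl
  windowSum-vanishes {r} B B-vanishes (suc k) {suc n} (s≤s k+r≤n) = begin
    B (suc n) + windowSum k B n  ≡⟨ cong₂ _+_ (B-vanishes (s≤s (ℕ.≤-trans (ℕ.m≤n+m r k) k+r≤n)))
                                             (windowSum-vanishes B B-vanishes k k+r≤n) ⟩
    0# + 0#                      ≡⟨ +-identityʳ 0# ⟩
    0#                           ∎

  NonnegCoeffs-cong : ∀ {d c c′} → c ≗ c′ → NonnegCoeffs d c → NonnegCoeffs d c′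
  NonnegCoeffs-cong c≗c′ c≥0 l l≤d = subst (0# ≤_) (c≗c′ l) (c≥0 l l≤d)

  Unimodal-cong : ∀ {d c c′} → c ≗ c′ → Unimodal d c → Unimodal d c′
  Unimodal-cong c≗c′ (p , p≤d , rising , falling) =
    p , p≤d ,
    (λ l l<p → subst₂ _≤_ (c≗c′ l) (c≗c′ (suc l)) (rising l l<p)) ,
    (λ l p≤l l<d → subst₂ _≤_ (c≗c′ (suc l)) (c≗c′ l) (falling l p≤l l<d))

  module UnimodalWindowSum {r s : ℕ} (B : ℕ → Carrier) (B-vanishes : ∀ {n} → r ℕ.< n → B n ≡ 0#)
      (W≥0 : NonnegCoeffs (r ℕ.+ s) (windowSum (suc s) B)) (p : ℕ)
      (rising : ∀ l → l ℕ.< p → windowSum (suc s) B l ≤ windowSum (suc s) B (suc l))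
      (falling : ∀ l → p ℕ.≤ l → l ℕ.< r ℕ.+ s →
                 windowSum (suc s) B (suc l) ≤ windowSum (suc s) B l) where

    W : ℕ → Carrier
    W = windowSum (suc s) B

    falling-to-end : ∀ l → p ℕ.≤ l → l ℕ.≤ r ℕ.+ s → W (suc l) ≤ W l
    falling-to-end l p≤l l≤d with ℕ.m≤n⇒m<n∨m≡n l≤d
    ... | inj₁ l<d  = falling l p≤l l<d
    ... | inj₂ refl = subst (_≤ W l) (sym W-beyond-end) (W≥0 l l≤d)
      where
      W-beyond-end : W (suc l) ≡ 0#
      W-beyond-end = windowSum-vanishes B B-vanishes (suc s) (s≤s (ℕ.≤-reflexive (ℕ.+-comm s r)))

    nonneg-up-to-peak : ∀ n → n ℕ.≤ p → 0# ≤ B n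
    nonneg-up-to-peak = <-rec _ λ where
      zero    _ _   → subst (0# ≤_) (+-identityʳ (B 0)) (W≥0 0 z≤n)
      (suc n) ih n<p → ≤-trans
        (delay-nonneg s B n λ m m≤n → ih (s≤s m≤n) (ℕ.≤-trans (ℕ.m≤n⇒m≤1+n m≤n) n<p))
        (≤-balance (sym (windowSum-suc (suc s) B (suc n))) (rising n n<p))

    nonneg-from-peak : ∀ n → p ℕ.≤ n → 0# ≤ B n
    nonneg-from-peak = <-rec-downward _ r
      (λ r<n _ → ≤-reflexive (sym (B-vanishes r<n)))
      λ {m} m≤r ih p≤m →
        let m≤s+m = ℕ.m≤n+m m s
            s+m≤d = ℕ.≤-trans (ℕ.+-monoʳ-≤ s m≤r) (ℕ.≤-reflexive (ℕ.+-comm s r))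
        in ≤-trans (ih (s≤s m≤s+m) (ℕ.≤-trans p≤m (ℕ.m≤n⇒m≤1+n m≤s+m)))
             (≤-balance (exchange m) (falling-to-end (s ℕ.+ m) (ℕ.≤-trans p≤m m≤s+m) s+m≤d))
      where
      exchange : ∀ m → W (s ℕ.+ m) + B (suc (s ℕ.+ m)) ≡ B m + W (suc (s ℕ.+ m))
      exchange m = begin
        W (s ℕ.+ m) + B (suc (s ℕ.+ m))           ≡⟨ +-comm _ _ ⟩
        B (suc (s ℕ.+ m)) + W (s ℕ.+ m)           ≡⟨ windowSum-suc (suc s) B (suc (s ℕ.+ m)) ⟩
        W (suc (s ℕ.+ m)) + delay s B (s ℕ.+ m)   ≡⟨ cong (W (suc (s ℕ.+ m)) +_) (delay-+ s B m) ⟩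
        W (suc (s ℕ.+ m)) + B m                   ≡⟨ +-comm _ _ ⟩
        B m + W (suc (s ℕ.+ m))                   ∎

    nonneg : ∀ n → 0# ≤ B n
    nonneg n with n ℕ.≤? p
    ... | yes n≤p = nonneg-up-to-peak n n≤p
    ... | no  n≰p = nonneg-from-peak n (ℕ.<⇒≤ (ℕ.≰⇒> n≰p))

  windowSum-unimodal⇒nonneg : ∀ {r s} (B : ℕ → Carrier) → (∀ {n} → r ℕ.< n → B n ≡ 0#) →
    NonnegCoeffs (r ℕ.+ s) (windowSum (suc s) B) →
    Unimodal (r ℕ.+ s) (windowSum (suc s) B) →
    ∀ n → 0# ≤ B n
  windowSum-unimodal⇒nonneg B B-vanishes W≥0 (p , _ , rising , falling) =
    UnimodalWindowSum.nonneg B B-vanishes W≥0 p rising falling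

open import Data.Nat using (_+_)

proposition2p4 : ∀ {c ℓ} (R : OrderedCommRing c ℓ) (r s : ℕ)
    (b : Vec (OrderedCommRing.Carrier R) (suc r)) →
    Poly.NonnegCoeffs R (r + s) (Poly.fCoeff R s b) →
    Poly.Unimodal R (r + s) (Poly.fCoeff R s b) →
    ∀ (i : Fin (suc r)) → OrderedCommRing._≤_ R (OrderedCommRing.0# R) (lookup b i)
proposition2p4 R r s b f≥0 f-unimodal i =
  subst (0# ≤_) (sym (lookup≡coeff-toList R b i))
    (windowSum-unimodal⇒nonneg R (coeff (toList b)) (coeff-toList-≥ R b)
      (NonnegCoeffs-cong R f≡windowSum f≥0) (Unimodal-cong R f≡windowSum f-unimodal) (toℕ i))
  where
  open OrderedCommRing R using (_≤_; 0#)
  open Poly R using (coeff)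
  f≡windowSum : Poly.fCoeff R s b ≗ windowSum R (suc s) (coeff (toList b))
  f≡windowSum = coeff-replicate-1#-*ₚ R (suc s) (toList b)
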